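{- Let $\mathcal{C}=\{c_1,\ldots,c_m\}$ be a collection of cliques with graph union $U$. The number of edges of $U$ is \[ \frac12\sum_{\emptyset\neq J\subseteq\{1,\ldots,m\}}\gamma_J\left(\sum_{I\subseteq\{1,\ldots,m\}:\ |I\cap J|\ge 1}\gamma_I-1\right). \]
   Context: A clique is identified with its vertex set. The graph union $U$ of $c_1,\ldots,c_m$ has vertex set $V=\bigcup_j c_j$, and distinct $u,v\in V$ are adjacent iff $u,v\in c_j$ for some $j$. For $J\subseteq\{1,\ldots,m\}$, $\Gamma_J$ is the set of $v\in V$ with $\{j:v\in c_j\}=J$, and $\gamma_J=|\Gamma_J|$. -}

module Defs where

open import Data.Nat using (ℕ; zero; suc)
open import Data.Bool using (Bool; true; false)
open import Data.Bool.Properties using () renaming (_≟_ to _≟ᵇ_)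
open import Data.Fin using (Fin; _<_; _<?_)
open import Data.Fin.Subset using (Subset; _∈_; _∩_; ∣_∣; ⋃; inside; outside)
open import Data.Fin.Subset.Properties using (_∈?_)
open import Data.Fin.Properties using (any?)
open import Data.Vec using (Vec; []; _∷_; tabulate)
open import Data.Vec.Properties using (≡-dec)
open import Data.List using (List; []; _∷_; map; _++_; filter; length; sum; allFin; cartesianProduct)
open import Data.Product using (_×_; _,_; ∃; proj₁; proj₂)
open import Relation.Nullary using (Dec; yes; no; ¬_; does)
open import Relation.Nullary.Decidable using (_×-dec_; ¬?)
open import Relation.Binary.PropositionalEquality using (_≡_)
open import Data.Integer using (ℤ; +_) renaming (_+_ to _+ℤ_; _*_ to _*ℤ_; _-_ to _-ℤ_)

allSubsets : (m : ℕ) → List (Subset m)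
allSubsets zero = [] ∷ []
allSubsets (suc m) = map (outside ∷_) (allSubsets m) ++ map (inside ∷_) (allSubsets m)

Σℤ : {A : Set} → List A → (A → ℤ) → ℤ
Σℤ [] f = + 0
Σℤ (x ∷ xs) f = f x +ℤ Σℤ xs f

module _ {n m : ℕ} (c : Fin m → Subset n) where

  V : Subset n
  V = ⋃ (Data.List.tabulate c)

  Adjacent : Fin n → Fin n → Set
  Adjacent u v = ¬ (u ≡ v) × ∃ λ j → u ∈ c j × v ∈ c j

  adjacent? : ∀ u v → Dec (Adjacent u v)
  adjacent? u v = ¬? (u Data.Fin.≟ v) ×-dec any? (λ j → (u ∈? c j) ×-dec (v ∈? c j))

  -- Number of edges of U: unordered pairs {u,v} (counted once, as u < v) that are adjacent.
  numEdges : ℕ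
  numEdges = length (filter (λ p → (proj₁ p <? proj₂ p) ×-dec adjacent? (proj₁ p) (proj₂ p))
                            (cartesianProduct (allFin n) (allFin n)))

  memberSet : Fin n → Subset m
  memberSet v = tabulate (λ j → does (v ∈? c j))

  -- γ_J = |Γ_J|, Γ_J = {v ∈ V : {j : v ∈ c_j} = J}.
  γ : Subset m → ℕ
  γ J = length (filter (λ v → (v ∈? V) ×-dec ≡-dec _≟ᵇ_ (memberSet v) J) (allFin n))

  Nonempty? : (J : Subset m) → Dec (¬ (J ≡ Data.Fin.Subset.⊥))
  Nonempty? J = ¬? (≡-dec _≟ᵇ_ J Data.Fin.Subset.⊥)

  cliqueFormula : ℤ
  cliqueFormula =
    Σℤ (filter Nonempty? (allSubsets m)) λ J →
      (+ γ J) *ℤ (Σℤ (filter (λ I → Data.Nat._≤?_ 1 ∣ I ∩ J ∣) (allSubsets m)) (λ I → + γ I) -ℤ + 1)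

-- Counting ordered adjacent pairs gives 2|E| = Σ_u deg u. A vertex u ∈ Γ_J is
-- adjacent to exactly the other vertices whose membership set meets J, so
-- deg u = N J − 1 with N J = Σ_{I ∩ J ≠ ∅} γ_I, the −1 removing u itself.
-- Grouping the vertices of U by their membership set J turns Σ_u deg u into
-- Σ_{J ≠ ∅} γ_J (N J − 1).
module Submission where

open import Defs
open import Data.Nat using (ℕ; zero; suc; _≤_; _≤?_; s≤s; z≤n)
open import Data.Nat.Properties using (≤-trans)
open import Data.Bool using (Bool; true; false; if_then_else_)
open import Data.Bool.Properties using () renaming (_≟_ to _≟ᵇ_)
open import Data.Fin using (Fin; _<?_)
open import Data.Fin.Properties using (_≟_; <-cmp)
open import Data.Fin.Subset using (Subset; _∈_; _∩_; ∣_∣; ⋃; inside; outside; Nonempty; ⊥)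
open import Data.Fin.Subset.Properties
  using (_∈?_; ∉⊥; x∈p∩q⁺; x∈p∩q⁻; x∈p∪q⁻; x∈p∪q⁺; x∈p⇒∣p-x∣<∣p∣)
open import Data.Vec using ([]; _∷_; here; there)
open import Data.Vec.Properties using (≡-dec; []=⇒lookup; lookup⇒[]=; lookup∘tabulate)
open import Data.List using (List; []; _∷_; _++_; map; filter; length; allFin; cartesianProduct)
import Data.List as List
open import Data.List.Properties using (map-tabulate)
open import Data.Integer using (ℤ; +_; _+_; _-_; _*_)
open import Data.Integer.Properties
  using (+-identityˡ; +-identityʳ; *-identityˡ; *-zeroʳ; *-assoc; *-comm; *-distribˡ-+; pos-+)
open import Data.Integer.Solver using (module +-*-Solver)
open import Data.Product using (_×_; _,_; ∃)
open import Data.Sum using (inj₁; inj₂)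
open import Function using (_∘_; _⇔_; mk⇔; Equivalence)
open import Relation.Nullary using (Dec; yes; no; ¬_; does; contradiction)
open import Relation.Nullary.Decidable using (_×-dec_; does-⇔; dec-true; dec-false; decidable-stable)
open import Relation.Binary using (Symmetric; tri<; tri≈; tri>)
open import Relation.Binary.PropositionalEquality
  using (_≡_; refl; sym; trans; cong; cong₂; module ≡-Reasoning)

open +-*-Solver using (solve; con; _:+_; _:-_; _:*_; _:=_)
open ≡-Reasoning

private
  variable
    A B : Set
    P Q : Set

indicator : Bool → ℤ
indicator b = if b then + 1 else + 0

χ : Dec P → ℤ
χ p = indicator (does p)

χ-⇔ : P ⇔ Q → (p : Dec P) (q : Dec Q) → χ p ≡ χ q
χ-⇔ P⇔Q p q = cong indicator (does-⇔ P⇔Q p q)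

χ-yes : (p : Dec P) → P → χ p ≡ + 1
χ-yes p x = cong indicator (dec-true p x)

χ-no : (p : Dec P) → ¬ P → χ p ≡ + 0
χ-no p ¬x = cong indicator (dec-false p ¬x)

does≡true⇒ : (p : Dec P) → does p ≡ true → P
does≡true⇒ (yes x) _  = x
does≡true⇒ (no _)  ()

χ-× : (p : Dec P) (q : Dec Q) → χ (p ×-dec q) ≡ χ p * χ q
χ-× p q with does p
... | true  = sym (*-identityˡ (χ q))
... | false = refl

Σℤ-cong : (xs : List A) {f g : A → ℤ} → (∀ x → f x ≡ g x) → Σℤ xs f ≡ Σℤ xs g
Σℤ-cong []       f≗g = refl
Σℤ-cong (x ∷ xs) f≗g = cong₂ _+_ (f≗g x) (Σℤ-cong xs f≗g)

Σℤ-zero : (xs : List A) → Σℤ xs (λ _ → + 0) ≡ + 0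
Σℤ-zero []       = refl
Σℤ-zero (x ∷ xs) = trans (+-identityˡ _) (Σℤ-zero xs)

Σℤ-++ : (xs ys : List A) (f : A → ℤ) → Σℤ (xs ++ ys) f ≡ Σℤ xs f + Σℤ ys f
Σℤ-++ []       ys f = sym (+-identityˡ _)
Σℤ-++ (x ∷ xs) ys f rewrite Σℤ-++ xs ys f =
  solve 3 (λ a s t → a :+ (s :+ t) := (a :+ s) :+ t) refl (f x) (Σℤ xs f) (Σℤ ys f)

Σℤ-map : (g : A → B) (xs : List A) (f : B → ℤ) → Σℤ (map g xs) f ≡ Σℤ xs (f ∘ g)
Σℤ-map g []       f = refl
Σℤ-map g (x ∷ xs) f = cong (_+_ (f (g x))) (Σℤ-map g xs f)

Σℤ-+ : (xs : List A) (f g : A → ℤ) → Σℤ xs (λ x → f x + g x) ≡ Σℤ xs f + Σℤ xs g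
Σℤ-+ []       f g = refl
Σℤ-+ (x ∷ xs) f g rewrite Σℤ-+ xs f g =
  solve 4 (λ a b s t → (a :+ b) :+ (s :+ t) := (a :+ s) :+ (b :+ t)) refl
    (f x) (g x) (Σℤ xs f) (Σℤ xs g)

Σℤ-- : (xs : List A) (f g : A → ℤ) → Σℤ xs (λ x → f x - g x) ≡ Σℤ xs f - Σℤ xs g
Σℤ-- []       f g = refl
Σℤ-- (x ∷ xs) f g rewrite Σℤ-- xs f g =
  solve 4 (λ a b s t → (a :- b) :+ (s :- t) := (a :+ s) :- (b :+ t)) refl
    (f x) (g x) (Σℤ xs f) (Σℤ xs g)

Σℤ-*ˡ : (xs : List A) (k : ℤ) (f : A → ℤ) → Σℤ xs (λ x → k * f x) ≡ k * Σℤ xs f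
Σℤ-*ˡ []       k f = sym (*-zeroʳ k)
Σℤ-*ˡ (x ∷ xs) k f rewrite Σℤ-*ˡ xs k f = sym (*-distribˡ-+ k (f x) (Σℤ xs f))

Σℤ-*ʳ : (xs : List A) (f : A → ℤ) (k : ℤ) → Σℤ xs (λ x → f x * k) ≡ Σℤ xs f * k
Σℤ-*ʳ xs f k = begin
  Σℤ xs (λ x → f x * k) ≡⟨ Σℤ-cong xs (λ x → *-comm (f x) k) ⟩
  Σℤ xs (λ x → k * f x) ≡⟨ Σℤ-*ˡ xs k f ⟩
  k * Σℤ xs f           ≡⟨ *-comm k (Σℤ xs f) ⟩
  Σℤ xs f * k           ∎

Σℤ-swap : (xs : List A) (ys : List B) (f : A → B → ℤ) →
  Σℤ xs (λ x → Σℤ ys (f x)) ≡ Σℤ ys (λ y → Σℤ xs (λ x → f x y))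
Σℤ-swap []       ys f = sym (Σℤ-zero ys)
Σℤ-swap (x ∷ xs) ys f rewrite Σℤ-swap xs ys f = sym (Σℤ-+ ys (f x) (λ y → Σℤ xs (λ x → f x y)))

Σℤ-cartesianProduct : (xs : List A) (ys : List B) (f : A × B → ℤ) →
  Σℤ (cartesianProduct xs ys) f ≡ Σℤ xs (λ x → Σℤ ys (λ y → f (x , y)))
Σℤ-cartesianProduct []       ys f = refl
Σℤ-cartesianProduct (x ∷ xs) ys f = begin
  Σℤ (map (x ,_) ys ++ cartesianProduct xs ys) f
    ≡⟨ Σℤ-++ (map (x ,_) ys) _ f ⟩
  Σℤ (map (x ,_) ys) f + Σℤ (cartesianProduct xs ys) f
    ≡⟨ cong₂ _+_ (Σℤ-map (x ,_) ys f) (Σℤ-cartesianProduct xs ys f) ⟩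
  Σℤ ys (λ y → f (x , y)) + Σℤ xs (λ x → Σℤ ys (λ y → f (x , y))) ∎

Σℤ-filter : {R : A → Set} (R? : ∀ x → Dec (R x)) (xs : List A) (f : A → ℤ) →
  Σℤ (filter R? xs) f ≡ Σℤ xs (λ x → χ (R? x) * f x)
Σℤ-filter R? []       f = refl
Σℤ-filter R? (x ∷ xs) f with does (R? x)
... | true  = cong₂ _+_ (sym (*-identityˡ (f x))) (Σℤ-filter R? xs f)
... | false = trans (Σℤ-filter R? xs f) (sym (+-identityˡ _))

length-filter : {R : A → Set} (R? : ∀ x → Dec (R x)) (xs : List A) →
  + length (filter R? xs) ≡ Σℤ xs (χ ∘ R?)
length-filter R? []       = refl
length-filter R? (x ∷ xs) with does (R? x)
... | true  = trans (pos-+ 1 _) (cong (_+_ (+ 1)) (length-filter R? xs))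
... | false = trans (length-filter R? xs) (sym (+-identityˡ _))

Σℤ-allFin-suc : ∀ n (f : Fin (suc n) → ℤ) →
  Σℤ (allFin (suc n)) f ≡ f Fin.zero + Σℤ (allFin n) (f ∘ Fin.suc)
Σℤ-allFin-suc n f = cong (_+_ (f Fin.zero)) (begin
  Σℤ (List.tabulate Fin.suc) f        ≡⟨ cong (λ xs → Σℤ xs f) (map-tabulate (λ i → i) Fin.suc) ⟨
  Σℤ (map Fin.suc (allFin n)) f       ≡⟨ Σℤ-map Fin.suc (allFin n) f ⟩
  Σℤ (allFin n) (f ∘ Fin.suc)         ∎)

Σℤ-allFin-δ : ∀ {n} (u : Fin n) → Σℤ (allFin n) (λ v → χ (u ≟ v)) ≡ + 1
Σℤ-allFin-δ {suc n} Fin.zero    =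
  trans (Σℤ-allFin-suc n (λ v → χ (Fin.zero ≟ v))) (cong (_+_ (+ 1)) (Σℤ-zero (allFin n)))
Σℤ-allFin-δ {suc n} (Fin.suc u) =
  trans (Σℤ-allFin-suc n (λ v → χ (Fin.suc u ≟ v))) (trans (+-identityˡ _) (Σℤ-allFin-δ u))

Σℤ-allSubsets-δ : ∀ {m} (S : Subset m) (h : Subset m → ℤ) →
  Σℤ (allSubsets m) (λ I → χ (≡-dec _≟ᵇ_ S I) * h I) ≡ h S
Σℤ-allSubsets-δ {zero}  []      h = trans (+-identityʳ _) (*-identityˡ (h []))
Σℤ-allSubsets-δ {suc m} (s ∷ S) h = begin
  Σℤ (map (outside ∷_) (allSubsets m) ++ map (inside ∷_) (allSubsets m)) δh
    ≡⟨ Σℤ-++ (map (outside ∷_) (allSubsets m)) _ δh ⟩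
  Σℤ (map (outside ∷_) (allSubsets m)) δh + Σℤ (map (inside ∷_) (allSubsets m)) δh
    ≡⟨ cong₂ _+_ (Σℤ-map (outside ∷_) (allSubsets m) δh) (Σℤ-map (inside ∷_) (allSubsets m) δh) ⟩
  Σℤ (allSubsets m) (δh ∘ (outside ∷_)) + Σℤ (allSubsets m) (δh ∘ (inside ∷_))
    ≡⟨ split s ⟩
  h (s ∷ S) ∎
  where
  δh : Subset (suc m) → ℤ
  δh I = χ (≡-dec _≟ᵇ_ (s ∷ S) I) * h I

  split : ∀ s → Σℤ (allSubsets m) (λ I → χ (≡-dec _≟ᵇ_ (s ∷ S) (outside ∷ I)) * h (outside ∷ I))
                + Σℤ (allSubsets m) (λ I → χ (≡-dec _≟ᵇ_ (s ∷ S) (inside ∷ I)) * h (inside ∷ I))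
              ≡ h (s ∷ S)
  split false = begin
    Σℤ (allSubsets m) (λ I → χ (≡-dec _≟ᵇ_ S I) * h (outside ∷ I)) + Σℤ (allSubsets m) (λ _ → + 0)
      ≡⟨ cong₂ _+_ (Σℤ-allSubsets-δ S (h ∘ (outside ∷_))) (Σℤ-zero (allSubsets m)) ⟩
    h (outside ∷ S) + + 0
      ≡⟨ +-identityʳ _ ⟩
    h (outside ∷ S) ∎
  split true  = begin
    Σℤ (allSubsets m) (λ _ → + 0) + Σℤ (allSubsets m) (λ I → χ (≡-dec _≟ᵇ_ S I) * h (inside ∷ I))
      ≡⟨ cong₂ _+_ (Σℤ-zero (allSubsets m)) (Σℤ-allSubsets-δ S (h ∘ (inside ∷_))) ⟩
    + 0 + h (inside ∷ S)
      ≡⟨ +-identityˡ _ ⟩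
    h (inside ∷ S) ∎

Σℤ-fibres : ∀ {m} (xs : List A) (w : A → ℤ) (g : A → Subset m) (h : Subset m → ℤ) →
  Σℤ xs (λ x → w x * h (g x)) ≡
  Σℤ (allSubsets m) (λ I → Σℤ xs (λ x → w x * χ (≡-dec _≟ᵇ_ (g x) I)) * h I)
Σℤ-fibres {A = A} {m = m} xs w g h = begin
  Σℤ xs (λ x → w x * h (g x))
    ≡⟨ Σℤ-cong xs (λ x → cong (w x *_) (Σℤ-allSubsets-δ (g x) h)) ⟨
  Σℤ xs (λ x → w x * Σℤ (allSubsets m) (λ I → δ x I * h I))
    ≡⟨ Σℤ-cong xs (λ x → Σℤ-*ˡ (allSubsets m) (w x) (λ I → δ x I * h I)) ⟨
  Σℤ xs (λ x → Σℤ (allSubsets m) (λ I → w x * (δ x I * h I)))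
    ≡⟨ Σℤ-swap xs (allSubsets m) _ ⟩
  Σℤ (allSubsets m) (λ I → Σℤ xs (λ x → w x * (δ x I * h I)))
    ≡⟨ Σℤ-cong (allSubsets m) (λ I → Σℤ-cong xs (λ x → *-assoc (w x) (δ x I) (h I))) ⟨
  Σℤ (allSubsets m) (λ I → Σℤ xs (λ x → w x * δ x I * h I))
    ≡⟨ Σℤ-cong (allSubsets m) (λ I → Σℤ-*ʳ xs (λ x → w x * δ x I) (h I)) ⟩
  Σℤ (allSubsets m) (λ I → Σℤ xs (λ x → w x * δ x I) * h I) ∎
  where
  δ : A → Subset m → ℤ
  δ x I = χ (≡-dec _≟ᵇ_ (g x) I)

1≤∣p∣⇔Nonempty : ∀ {n} (p : Subset n) → (1 ≤ ∣ p ∣) ⇔ Nonempty p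
1≤∣p∣⇔Nonempty p = mk⇔ (to p) (λ (x , x∈p) → ≤-trans (s≤s z≤n) (x∈p⇒∣p-x∣<∣p∣ x∈p))
  where
  to : ∀ {n} (p : Subset n) → 1 ≤ ∣ p ∣ → Nonempty p
  to (inside  ∷ p) _   = Fin.zero , here
  to (outside ∷ p) 1≤∣p∣ = let (x , x∈p) = to p 1≤∣p∣ in Fin.suc x , there x∈p

1≤∣p∩q∣⇔∃∈×∈ : ∀ {n} {p q : Subset n} → (1 ≤ ∣ p ∩ q ∣) ⇔ ∃ λ x → x ∈ p × x ∈ q
1≤∣p∩q∣⇔∃∈×∈ {p = p} {q} = mk⇔
  (λ meet → let (x , x∈p∩q) = Equivalence.to (1≤∣p∣⇔Nonempty (p ∩ q)) meet in x , x∈p∩q⁻ p q x∈p∩q)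
  (λ (x , x∈p , x∈q) → Equivalence.from (1≤∣p∣⇔Nonempty (p ∩ q)) (x , x∈p∩q⁺ (x∈p , x∈q)))

∈-⋃-tabulate : ∀ {m n} (f : Fin m → Subset n) {x} → x ∈ ⋃ (List.tabulate f) ⇔ ∃ λ j → x ∈ f j
∈-⋃-tabulate f = mk⇔ (to f) (from f)
  where
  to : ∀ {m n} (f : Fin m → Subset n) {x} → x ∈ ⋃ (List.tabulate f) → ∃ λ j → x ∈ f j
  to {zero}  f x∈⋃ = contradiction x∈⋃ ∉⊥
  to {suc m} f x∈⋃ with x∈p∪q⁻ (f Fin.zero) _ x∈⋃
  ... | inj₁ x∈f₀ = Fin.zero , x∈f₀
  ... | inj₂ x∈⋃′ = let (j , x∈fⱼ) = to (f ∘ Fin.suc) x∈⋃′ in Fin.suc j , x∈fⱼ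

  from : ∀ {m n} (f : Fin m → Subset n) {x} → (∃ λ j → x ∈ f j) → x ∈ ⋃ (List.tabulate f)
  from f (Fin.zero  , x∈f₀) = x∈p∪q⁺ (inj₁ x∈f₀)
  from f (Fin.suc j , x∈fⱼ) = x∈p∪q⁺ {p = f Fin.zero} (inj₂ (from (f ∘ Fin.suc) (j , x∈fⱼ)))

module _ {n : ℕ} {R : Fin n → Fin n → Set} (R? : ∀ u v → Dec (R u v))
         (R-sym : Symmetric R) (R-irrefl : ∀ u → ¬ R u u) where

  private
    χ-split : ∀ u v → χ (R? u v) ≡ χ (u <? v) * χ (R? u v) + χ (v <? u) * χ (R? v u)
    χ-split u v with <-cmp u v
    ... | tri< u<v _ v≮u rewrite χ-yes (u <? v) u<v | χ-no (v <? u) v≮u =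
      sym (trans (+-identityʳ _) (*-identityˡ (χ (R? u v))))
    ... | tri≈ u≮u refl _ rewrite χ-no (u <? u) u≮u | χ-no (R? u u) (R-irrefl u) = refl
    ... | tri> u≮v _ v<u rewrite χ-no (u <? v) u≮v | χ-yes (v <? u) v<u =
      trans (χ-⇔ (mk⇔ R-sym R-sym) (R? u v) (R? v u))
            (sym (trans (+-identityˡ _) (*-identityˡ (χ (R? v u)))))

  handshake : + 2 * Σℤ (allFin n) (λ u → Σℤ (allFin n) (λ v → χ (u <? v) * χ (R? u v)))
            ≡ Σℤ (allFin n) (λ u → Σℤ (allFin n) (λ v → χ (R? u v)))
  handshake = begin
    + 2 * pairs
      ≡⟨ solve 1 (λ s → con (+ 2) :* s := s :+ s) refl pairs ⟩
    pairs + pairs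
      ≡⟨ cong (_+_ pairs) (Σℤ-swap (allFin n) (allFin n) (λ v u → χ (v <? u) * χ (R? v u))) ⟩
    pairs + Σℤ (allFin n) (λ u → Σℤ (allFin n) (λ v → χ (v <? u) * χ (R? v u)))
      ≡⟨ Σℤ-+ (allFin n) _ _ ⟨
    Σℤ (allFin n) (λ u → pairsFrom u + Σℤ (allFin n) (λ v → χ (v <? u) * χ (R? v u)))
      ≡⟨ Σℤ-cong (allFin n) (λ u → Σℤ-+ (allFin n) _ _) ⟨
    Σℤ (allFin n) (λ u → Σℤ (allFin n) (λ v → χ (u <? v) * χ (R? u v) + χ (v <? u) * χ (R? v u)))
      ≡⟨ Σℤ-cong (allFin n) (λ u → Σℤ-cong (allFin n) (λ v → χ-split u v)) ⟨
    Σℤ (allFin n) (λ u → Σℤ (allFin n) (λ v → χ (R? u v))) ∎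
    where
    pairsFrom : Fin n → ℤ
    pairsFrom u = Σℤ (allFin n) (λ v → χ (u <? v) * χ (R? u v))
    pairs : ℤ
    pairs = Σℤ (allFin n) pairsFrom

module _ {n m : ℕ} (c : Fin m → Subset n) where

  ∈-memberSet : ∀ {v j} → j ∈ memberSet c v ⇔ v ∈ c j
  ∈-memberSet {v} {j} = mk⇔
    (λ j∈ → does≡true⇒ (v ∈? c j) (trans (sym (lookup∘tabulate member j)) ([]=⇒lookup j∈)))
    (λ v∈ → lookup⇒[]= j _ (trans (lookup∘tabulate member j) (dec-true (v ∈? c j) v∈)))
    where
    member : Fin m → Bool
    member j = does (v ∈? c j)

  ∈-V : ∀ {v} → v ∈ V c ⇔ Nonempty (memberSet c v)
  ∈-V = mk⇔
    (λ v∈V → let (j , v∈cⱼ) = Equivalence.to (∈-⋃-tabulate c) v∈V in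
             j , Equivalence.from ∈-memberSet v∈cⱼ)
    (λ (j , j∈) → Equivalence.from (∈-⋃-tabulate c) (j , Equivalence.to ∈-memberSet j∈))

  adjacent-sym : Symmetric (Adjacent c)
  adjacent-sym (u≢v , j , u∈cⱼ , v∈cⱼ) = u≢v ∘ sym , j , v∈cⱼ , u∈cⱼ

  adjacent-irrefl : ∀ u → ¬ Adjacent c u u
  adjacent-irrefl u (u≢u , _) = u≢u refl

  adjacent⇔meet : ∀ {u v} → ¬ u ≡ v → Adjacent c u v ⇔ 1 ≤ ∣ memberSet c v ∩ memberSet c u ∣
  adjacent⇔meet u≢v = mk⇔
    (λ (_ , j , u∈cⱼ , v∈cⱼ) →
       Equivalence.from 1≤∣p∩q∣⇔∃∈×∈
         (j , Equivalence.from ∈-memberSet v∈cⱼ , Equivalence.from ∈-memberSet u∈cⱼ))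
    (λ meet → let (j , j∈Mv , j∈Mu) = Equivalence.to 1≤∣p∩q∣⇔∃∈×∈ meet in
              u≢v , j , Equivalence.to ∈-memberSet j∈Mu , Equivalence.to ∈-memberSet j∈Mv)

  meet⇒∈V : ∀ {v} {J : Subset m} → 1 ≤ ∣ memberSet c v ∩ J ∣ → v ∈ V c
  meet⇒∈V meet = let (j , j∈Mv , _) = Equivalence.to 1≤∣p∩q∣⇔∃∈×∈ meet in
                 Equivalence.from ∈-V (j , j∈Mv)

  χ-adjacent : ∀ u v → χ (adjacent? c u v)
             ≡ χ (u ∈? V c) * (χ (1 ≤? ∣ memberSet c v ∩ memberSet c u ∣) - χ (u ≟ v))
  χ-adjacent u v = by-cases (u ∈? V c) (u ≟ v)
    where
    by-cases : (u∈?V : Dec (u ∈ V c)) (u≟v : Dec (u ≡ v)) →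
      χ (adjacent? c u v) ≡ χ u∈?V * (χ (1 ≤? ∣ memberSet c v ∩ memberSet c u ∣) - χ u≟v)
    by-cases (no u∉V) _ =
      χ-no (adjacent? c u v) (λ (_ , j , u∈cⱼ , _) → u∉V (Equivalence.from (∈-⋃-tabulate c) (j , u∈cⱼ)))
    by-cases (yes u∈V) (yes refl) = trans (χ-no (adjacent? c u u) (adjacent-irrefl u))
                                          (cong (λ x → + 1 * (x - + 1)) (sym (χ-yes (1 ≤? _) self-meet)))
      where
      self-meet : 1 ≤ ∣ memberSet c u ∩ memberSet c u ∣
      self-meet = let (j , j∈) = Equivalence.to ∈-V u∈V in Equivalence.from 1≤∣p∩q∣⇔∃∈×∈ (j , j∈ , j∈)
    by-cases (yes u∈V) (no u≢v) = trans (χ-⇔ (adjacent⇔meet u≢v) (adjacent? c u v) (1 ≤? _))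
                                        (sym (trans (*-identityˡ _) (+-identityʳ _)))

  γ-as-Σℤ : ∀ I → + γ c I ≡ Σℤ (allFin n) (λ v → χ (v ∈? V c) * χ (≡-dec _≟ᵇ_ (memberSet c v) I))
  γ-as-Σℤ I = trans (length-filter _ (allFin n))
    (Σℤ-cong (allFin n) (λ v → χ-× (v ∈? V c) (≡-dec _≟ᵇ_ (memberSet c v) I)))

  Σℤ-vertices-by-class : (h : Subset m → ℤ) →
    Σℤ (allFin n) (λ u → χ (u ∈? V c) * h (memberSet c u)) ≡ Σℤ (allSubsets m) (λ J → + γ c J * h J)
  Σℤ-vertices-by-class h = trans (Σℤ-fibres (allFin n) (λ u → χ (u ∈? V c)) (memberSet c) h)
                        (Σℤ-cong (allSubsets m) (λ J → cong (_* h J) (sym (γ-as-Σℤ J))))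

  χ-meet-∈V : ∀ v J → χ (1 ≤? ∣ memberSet c v ∩ J ∣) ≡ χ (v ∈? V c) * χ (1 ≤? ∣ memberSet c v ∩ J ∣)
  χ-meet-∈V v J with v ∈? V c
  ... | yes _  = sym (*-identityˡ _)
  ... | no v∉V = χ-no (1 ≤? _) (v∉V ∘ meet⇒∈V)

  meeting-count : ∀ J → Σℤ (allFin n) (λ v → χ (1 ≤? ∣ memberSet c v ∩ J ∣))
                      ≡ Σℤ (filter (λ I → 1 ≤? ∣ I ∩ J ∣) (allSubsets m)) (λ I → + γ c I)
  meeting-count J = begin
    Σℤ (allFin n) (λ v → χ (1 ≤? ∣ memberSet c v ∩ J ∣))
      ≡⟨ Σℤ-cong (allFin n) (λ v → χ-meet-∈V v J) ⟩
    Σℤ (allFin n) (λ v → χ (v ∈? V c) * χ (1 ≤? ∣ memberSet c v ∩ J ∣))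
      ≡⟨ Σℤ-vertices-by-class (λ I → χ (1 ≤? ∣ I ∩ J ∣)) ⟩
    Σℤ (allSubsets m) (λ I → + γ c I * χ (1 ≤? ∣ I ∩ J ∣))
      ≡⟨ Σℤ-cong (allSubsets m) (λ I → *-comm (+ γ c I) _) ⟩
    Σℤ (allSubsets m) (λ I → χ (1 ≤? ∣ I ∩ J ∣) * + γ c I)
      ≡⟨ Σℤ-filter (λ I → 1 ≤? ∣ I ∩ J ∣) (allSubsets m) (λ I → + γ c I) ⟨
    Σℤ (filter (λ I → 1 ≤? ∣ I ∩ J ∣) (allSubsets m)) (λ I → + γ c I) ∎

  classDegree : Subset m → ℤ
  classDegree J = Σℤ (filter (λ I → 1 ≤? ∣ I ∩ J ∣) (allSubsets m)) (λ I → + γ c I) - + 1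

  degree : ∀ u → Σℤ (allFin n) (λ v → χ (adjacent? c u v)) ≡ χ (u ∈? V c) * classDegree (memberSet c u)
  degree u = begin
    Σℤ (allFin n) (λ v → χ (adjacent? c u v))
      ≡⟨ Σℤ-cong (allFin n) (χ-adjacent u) ⟩
    Σℤ (allFin n) (λ v → χ (u ∈? V c) * (meet v - χ (u ≟ v)))
      ≡⟨ Σℤ-*ˡ (allFin n) (χ (u ∈? V c)) _ ⟩
    χ (u ∈? V c) * Σℤ (allFin n) (λ v → meet v - χ (u ≟ v))
      ≡⟨ cong (χ (u ∈? V c) *_) (Σℤ-- (allFin n) meet _) ⟩
    χ (u ∈? V c) * (Σℤ (allFin n) meet - Σℤ (allFin n) (λ v → χ (u ≟ v)))
      ≡⟨ cong (λ x → χ (u ∈? V c) * (Σℤ (allFin n) meet - x)) (Σℤ-allFin-δ u) ⟩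
    χ (u ∈? V c) * (Σℤ (allFin n) meet - + 1)
      ≡⟨ cong (λ x → χ (u ∈? V c) * (x - + 1)) (meeting-count (memberSet c u)) ⟩
    χ (u ∈? V c) * classDegree (memberSet c u) ∎
    where
    meet : Fin n → ℤ
    meet v = χ (1 ≤? ∣ memberSet c v ∩ memberSet c u ∣)

  γ-⊥ : + γ c ⊥ ≡ + 0
  γ-⊥ = trans (length-filter _ (allFin n)) (trans (Σℤ-cong (allFin n) not-in-Γ⊥) (Σℤ-zero (allFin n)))
    where
    nonempty⇒≢⊥ : {p : Subset m} → Nonempty p → ¬ p ≡ ⊥
    nonempty⇒≢⊥ (j , j∈p) refl = ∉⊥ j∈p

    not-in-Γ⊥ : ∀ v → χ ((v ∈? V c) ×-dec ≡-dec _≟ᵇ_ (memberSet c v) ⊥) ≡ + 0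
    not-in-Γ⊥ v = χ-no ((v ∈? V c) ×-dec ≡-dec _≟ᵇ_ (memberSet c v) ⊥)
                       (λ (v∈V , Mv≡⊥) → nonempty⇒≢⊥ (Equivalence.to ∈-V v∈V) Mv≡⊥)

  χ-nonempty-*γ : ∀ J (J≢⊥? : Dec (¬ J ≡ ⊥)) → χ J≢⊥? * + γ c J ≡ + γ c J
  χ-nonempty-*γ J (yes _)    = *-identityˡ _
  χ-nonempty-*γ J (no ¬J≢⊥) with refl ← decidable-stable (≡-dec _≟ᵇ_ J ⊥) ¬J≢⊥ = sym γ-⊥

  Σℤ-γ-nonempty : (f : Subset m → ℤ) →
    Σℤ (allSubsets m) (λ J → + γ c J * f J)
    ≡ Σℤ (filter (Nonempty? c) (allSubsets m)) (λ J → + γ c J * f J)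
  Σℤ-γ-nonempty f = sym (trans (Σℤ-filter (Nonempty? c) (allSubsets m) _)
    (Σℤ-cong (allSubsets m) (λ J → trans (sym (*-assoc (χ (Nonempty? c J)) _ (f J)))
                                          (cong (_* f J) (χ-nonempty-*γ J (Nonempty? c J))))))

  numEdges-as-Σℤ :
    + numEdges c ≡ Σℤ (allFin n) (λ u → Σℤ (allFin n) (λ v → χ (u <? v) * χ (adjacent? c u v)))
  numEdges-as-Σℤ = trans (length-filter _ (cartesianProduct (allFin n) (allFin n)))
    (trans (Σℤ-cartesianProduct (allFin n) (allFin n) _)
           (Σℤ-cong (allFin n) (λ u → Σℤ-cong (allFin n) (λ v → χ-× (u <? v) (adjacent? c u v)))))

proposition5p7 : (n m : ℕ) (c : Fin m → Subset n) →
    + 2 * + numEdges c ≡ cliqueFormula c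
proposition5p7 n m c = begin
  + 2 * + numEdges c
    ≡⟨ cong (+ 2 *_) (numEdges-as-Σℤ c) ⟩
  + 2 * Σℤ (allFin n) (λ u → Σℤ (allFin n) (λ v → χ (u <? v) * χ (adjacent? c u v)))
    ≡⟨ handshake (adjacent? c) (adjacent-sym c) (adjacent-irrefl c) ⟩
  Σℤ (allFin n) (λ u → Σℤ (allFin n) (λ v → χ (adjacent? c u v)))
    ≡⟨ Σℤ-cong (allFin n) (degree c) ⟩
  Σℤ (allFin n) (λ u → χ (u ∈? V c) * classDegree c (memberSet c u))
    ≡⟨ Σℤ-vertices-by-class c (classDegree c) ⟩
  Σℤ (allSubsets m) (λ J → + γ c J * classDegree c J)
    ≡⟨ Σℤ-γ-nonempty c (classDegree c) ⟩
  cliqueFormula c ∎
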